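{- Let $\phi$ be an arithmetical statement and $\pi$ a proof strategy with initial capital $\varepsilon$. If the probability that $\phi$ is proved by $\pi$ is greater than $\varepsilon$, then $\phi$ is provable in $\mathsf{PA}$ (without any additional axioms).
   Context: $\mathsf{PA}$ denotes Peano arithmetic. For a finite set $A$ of natural numbers, a rational $\tau>0$ and an arithmetical formula $R(x)$ with one free variable, $(\forall_\tau x\in A)R(x)$ denotes the arithmetical statement "the proportion of elements $n$ of $A$ such that $\lnot R(n)$ holds is at most $\tau$"; here $A$ is represented by a formula $A(x)$ such that $\mathsf{PA}\vdash A(\bar n)$ for $n\in A$, $\mathsf{PA}\vdash \lnot A(\bar n)$ for $n\notin A$, and the cardinality of $A$ is provable in $\mathsf{PA}$. A proof strategy with initial capital $\varepsilon$ is a finite rooted tree whose nodes are labeled by pairs $(T,\delta)$, $T$ a set of formulas and $\delta$ a rational in $[0,1]$; the root is labeled $(\mathsf{PA},\varepsilon)$. Each non-leaf node is either deterministic: it has one child, labeled $(T\cup\{\psi\},\delta)$ where $\psi$ is obtained from $T$ by an inference rule (or is an axiom); or probabilistic: $T$ contains a formula $(\forall_\tau n\in A)R(n)$ with $\tau\le\delta$, and the node has one child for each $n\in A$, labeled $(T\cup\{R(\bar n)\},\delta-\tau)$. The strategy is identified with the random process that starts at the root and at each probabilistic node moves to a uniformly chosen child until a leaf is reached. The probability that $\phi$ is proved by $\pi$ is the total probability of the leaves whose formula set contains $\phi$. -}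

module Defs where

open import Data.Nat using (ℕ; zero; suc; NonZero) renaming (_/_ to _/ℕ_; _*_ to _*ℕ_; _<_ to _<ℕ_)
open import Data.Integer using (ℤ; +_; ∣_∣)
open import Data.Rational using (ℚ; 0ℚ; 1ℚ; ↥_; ↧ₙ_; _/_; _+_; _*_; _-_; _≤_; _<_)
open import Data.Fin using (Fin)
import Data.Fin as Fin
open import Data.Vec using (Vec; lookup)
open import Data.Sum using (_⊎_)
open import Data.Product using (_×_; Σ)
open import Relation.Binary.PropositionalEquality using (_≡_; _≢_)
open import Relation.Nullary using (¬_)
open import Level using (Level) renaming (suc to lsuc)

infixl 7 _`*_
infixl 6 _`+_
infix  4 _`≐_
infixr 2 _`⇒_

data Term : Set where
  var  : ℕ → Term
  `0   : Term
  `S   : Term → Term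
  _`+_ : Term → Term → Term
  _`*_ : Term → Term → Term

data Formula : Set where
  `⊥   : Formula
  _`≐_ : Term → Term → Formula
  _`⇒_ : Formula → Formula → Formula
  `∀   : Formula → Formula        -- binds de Bruijn variable 0

ext : (ℕ → ℕ) → ℕ → ℕ
ext ρ zero    = zero
ext ρ (suc k) = suc (ρ k)

renT : (ℕ → ℕ) → Term → Term
renT ρ (var k)   = var (ρ k)
renT ρ `0        = `0
renT ρ (`S t)    = `S (renT ρ t)
renT ρ (t `+ s)  = renT ρ t `+ renT ρ s
renT ρ (t `* s)  = renT ρ t `* renT ρ s

renF : (ℕ → ℕ) → Formula → Formula
renF ρ `⊥        = `⊥
renF ρ (t `≐ s)  = renT ρ t `≐ renT ρ s
renF ρ (φ `⇒ ψ)  = renF ρ φ `⇒ renF ρ ψ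
renF ρ (`∀ φ)    = `∀ (renF (ext ρ) φ)

exts : (ℕ → Term) → ℕ → Term
exts σ zero    = var zero
exts σ (suc k) = renT suc (σ k)

subT : (ℕ → Term) → Term → Term
subT σ (var k)   = σ k
subT σ `0        = `0
subT σ (`S t)    = `S (subT σ t)
subT σ (t `+ s)  = subT σ t `+ subT σ s
subT σ (t `* s)  = subT σ t `* subT σ s

subF : (ℕ → Term) → Formula → Formula
subF σ `⊥        = `⊥
subF σ (t `≐ s)  = subT σ t `≐ subT σ s
subF σ (φ `⇒ ψ)  = subF σ φ `⇒ subF σ ψ
subF σ (`∀ φ)    = `∀ (subF (exts σ) φ)

shiftT : Term → Term
shiftT = renT suc

shift : Formula → Formula
shift = renF suc

-- φ[t/0]: substitute t for variable 0, lowering the other free variables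
single : Term → ℕ → Term
single t zero    = t
single t (suc k) = var k

inst : Term → Formula → Formula
inst t φ = subF (single t) φ

num : ℕ → Term
num zero    = `0
num (suc n) = `S (num n)

`¬ : Formula → Formula
`¬ φ = φ `⇒ `⊥

`⊤ : Formula
`⊤ = `¬ `⊥

infixr 3 _`∧_
_`∧_ : Formula → Formula → Formula
φ `∧ ψ = `¬ (φ `⇒ `¬ ψ)

`∃ : Formula → Formula
`∃ φ = `¬ (`∀ (`¬ φ))

_`<_ : Term → Term → Formula
t `< s = `∃ (shiftT t `+ `S (var zero) `≐ shiftT s)

∀ⁿ : ℕ → Formula → Formula
∀ⁿ zero    φ = φ
∀ⁿ (suc n) φ = `∀ (∀ⁿ n φ)

-- free variables: FmBelow n φ  means every free variable of φ is < n
data TmBelow (n : ℕ) : Term → Set where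
  var : ∀ {k} → k <ℕ n → TmBelow n (var k)
  z   : TmBelow n `0
  s   : ∀ {t} → TmBelow n t → TmBelow n (`S t)
  pl  : ∀ {t u} → TmBelow n t → TmBelow n u → TmBelow n (t `+ u)
  ti  : ∀ {t u} → TmBelow n t → TmBelow n u → TmBelow n (t `* u)

data FmBelow : ℕ → Formula → Set where
  bot : ∀ {n} → FmBelow n `⊥
  eq  : ∀ {n t u} → TmBelow n t → TmBelow n u → FmBelow n (t `≐ u)
  imp : ∀ {n φ ψ} → FmBelow n φ → FmBelow n ψ → FmBelow n (φ `⇒ ψ)
  all : ∀ {n φ} → FmBelow (suc n) φ → FmBelow n (`∀ φ)

Sentence : Formula → Set
Sentence = FmBelow zero

-- Hilbert calculus (Enderton style: axioms closed under generalization,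
-- only rule modus ponens)

data LogAx : Formula → Set where
  axK    : ∀ φ ψ → LogAx (φ `⇒ ψ `⇒ φ)
  axS    : ∀ φ ψ χ → LogAx ((φ `⇒ ψ `⇒ χ) `⇒ (φ `⇒ ψ) `⇒ φ `⇒ χ)
  axDNE  : ∀ φ → LogAx (`¬ (`¬ φ) `⇒ φ)
  axInst : ∀ φ t → LogAx (`∀ φ `⇒ inst t φ)
  axDist : ∀ φ ψ → LogAx (`∀ (φ `⇒ ψ) `⇒ `∀ φ `⇒ `∀ ψ)
  axVac  : ∀ φ → LogAx (φ `⇒ `∀ (shift φ))
  axRefl : ∀ t → LogAx (t `≐ t)
  axLeib : ∀ t s φ → LogAx (t `≐ s `⇒ inst t φ `⇒ inst s φ)
  axGen  : ∀ {φ} → LogAx φ → LogAx (`∀ φ)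

Theory : Set₁
Theory = Formula → Set

infix 1 _⊢_
data _⊢_ (T : Theory) : Formula → Set where
  ax  : ∀ {φ} → LogAx φ → T ⊢ φ
  hyp : ∀ {φ} → T φ → T ⊢ φ
  mp  : ∀ {φ ψ} → T ⊢ φ → T ⊢ (φ `⇒ ψ) → T ⊢ ψ

-- induction instance for φ (variable 0 is the induction variable)
succ0 : ℕ → Term
succ0 zero    = `S (var zero)
succ0 (suc k) = var (suc k)

Ind : Formula → Formula
Ind φ = inst `0 φ `⇒ `∀ (φ `⇒ subF succ0 φ) `⇒ `∀ φ

private
  v0 v1 : Term
  v0 = var 0
  v1 = var 1

data PA : Theory where
  pa1 : PA (`∀ (`¬ (`S v0 `≐ `0)))
  pa2 : PA (`∀ (`∀ (`S v1 `≐ `S v0 `⇒ v1 `≐ v0)))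
  pa3 : PA (`∀ (v0 `+ `0 `≐ v0))
  pa4 : PA (`∀ (`∀ (v1 `+ `S v0 `≐ `S (v1 `+ v0))))
  pa5 : PA (`∀ (v0 `* `0 `≐ `0))
  pa6 : PA (`∀ (`∀ (v1 `* `S v0 `≐ v1 `* v0 `+ v1)))
  ind : ∀ n φ → PA (∀ⁿ n (Ind φ))

_∪｛_｝ : Theory → Formula → Theory
(T ∪｛ ψ ｝) χ = T χ ⊎ χ ≡ ψ

-- Counting quantifiers.  P has variable 0 as the counted variable.

-- Above m P (var 0 = lower bound b): there are x₁ < … < xₘ, all > b, with P
Above : ℕ → Formula → Formula
Above zero    P = `⊤
Above (suc m) P =
  `∃ ((var 1 `< var 0) `∧ renF (ext suc) P `∧ Above m (renF (ext suc) P))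

AtLeast : ℕ → Formula → Formula
AtLeast zero    P = `⊤
AtLeast (suc m) P = `∃ (P `∧ Above m P)

AtMost : ℕ → Formula → Formula
AtMost k P = `¬ (AtLeast (suc k) P)

Exactly : ℕ → Formula → Formula
Exactly m P = AtLeast m P `∧ AtMost m P

record FinSet : Set where
  field
    size-1   : ℕ
    elems    : Vec ℕ (suc size-1)
    distinct : ∀ i j → lookup elems i ≡ lookup elems j → i ≡ j

  size : ℕ
  size = suc size-1

  elem : Fin size → ℕ
  elem = lookup elems

open FinSet public

Represents : FinSet → Formula → Set
Represents A Aφ =
  FmBelow 1 Aφ
  × (∀ i → PA ⊢ inst (num (elem A i)) Aφ)
  × (∀ n → (∀ i → elem A i ≢ n) → PA ⊢ `¬ (inst (num n) Aφ))
  × (PA ⊢ Exactly (size A) Aφ)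

-- (∀_τ x ∈ A) R(x): #{x : A(x) ∧ ¬R(x)} ≤ τ·|A|, i.e. ≤ ⌊τ·|A|⌋
⌊_·_⌋ : ℚ → ℕ → ℕ
⌊ τ · a ⌋ = (∣ ↥ τ ∣ *ℕ a) /ℕ (↧ₙ τ)

ForallTau : ℚ → FinSet → Formula → Formula → Formula
ForallTau τ A Aφ R = AtMost ⌊ τ · size A ⌋ (Aφ `∧ `¬ R)

Step : Theory → Formula → Set
Step T ψ = LogAx ψ ⊎ Σ Formula (λ χ → T χ × T (χ `⇒ ψ))

data Strategy : Theory → ℚ → Set₁ where
  leaf : ∀ {T δ} → Strategy T δ
  det  : ∀ {T δ} (ψ : Formula) → Step T ψ →
         Strategy (T ∪｛ ψ ｝) δ → Strategy T δ
  prob : ∀ {T δ} (A : FinSet) (Aφ R : Formula) (τ : ℚ) →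
         Represents A Aφ → FmBelow 1 R → 0ℚ < τ → τ ≤ δ →
         T (ForallTau τ A Aφ R) →
         ((i : Fin (size A)) → Strategy (T ∪｛ inst (num (elem A i)) R ｝) (δ - τ)) →
         Strategy T δ

sumFin : ∀ {n} → (Fin n → ℚ) → ℚ
sumFin {zero}  f = 0ℚ
sumFin {suc n} f = f Fin.zero + sumFin (λ i → f (Fin.suc i))

data ProbProved (φ : Formula) : ∀ {T δ} → Strategy T δ → ℚ → Set₁ where
  leaf-in  : ∀ {T δ} → T φ → ProbProved φ (leaf {T} {δ}) 1ℚ
  leaf-out : ∀ {T δ} → ¬ T φ → ProbProved φ (leaf {T} {δ}) 0ℚ
  det      : ∀ {T δ ψ st} {π : Strategy (T ∪｛ ψ ｝) δ} {p} →
             ProbProved φ π p → ProbProved φ (det {T} {δ} ψ st π) p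
  prob     : ∀ {T δ A Aφ R τ rep fb τ>0 τ≤δ mem}
               {ch : (i : Fin (size A)) → Strategy (T ∪｛ inst (num (elem A i)) R ｝) (δ - τ)}
               (ps : Fin (size A) → ℚ) →
             (∀ i → ProbProved φ (ch i) (ps i)) →
             ProbProved φ (prob {T} {δ} A Aφ R τ rep fb τ>0 τ≤δ mem ch)
                          (sumFin ps * ((+ 1) / size A))

module Submission where

-- We prove the stronger statement that for every theory T extending PA and
-- every node of capital δ ≥ 0 at which φ is proved with probability p > δ,
-- T ⊢ φ.  A leaf with p > δ ≥ 0 must
-- contain φ; a deterministic step is derivable, so it can be cut away.  At a
-- probabilistic node for (∀_τ x ∈ A) R(x), the children have capital δ − τ,
-- and an averaging argument shows that more than ⌊τ·|A|⌋ children succeed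
-- with probability above δ − τ.  For each such child the induction hypothesis
-- gives T ∪ {R(a)} ⊢ φ, hence T ∪ {¬φ} ⊢ A(a) ∧ ¬R(a).  Listing these a in
-- increasing order, T ∪ {¬φ} proves that at least ⌊τ·|A|⌋ + 1 elements of A
-- violate R, refuting the axiom (∀_τ x ∈ A) R(x) of T; so T ⊢ φ.

open import Defs
open import Data.Nat as ℕ using (ℕ; zero; suc; z≤n; s≤s)
  renaming (_<_ to _<ℕ_; _≤_ to _≤ℕ_)
import Data.Nat.Properties as ℕₚ
open import Data.Nat.DivMod using (m/n*n≤m)
open import Data.Integer as ℤ using (+_; -[1+_])
import Data.Integer.Properties as ℤₚ
open import Data.Rational
  using (ℚ; mkℚ; 0ℚ; 1ℚ; _+_; _*_; _-_; -_; _/_; _≤_; _<_; *≤*; *<*; toℚᵘ)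
open import Data.Rational.Properties
  using ( ≤-refl; ≤-reflexive; ≤-trans; <-irrefl; ≤-<-trans; <-≤-trans; ≮⇒≥
        ; +-mono-≤; +-monoʳ-≤; +-monoˡ-≤; +-identityʳ; +-inverseʳ; *-identityʳ
        ; *-monoʳ-≤-nonNeg; normalize-nonNeg; toℚᵘ-fromℚᵘ; toℚᵘ-cancel-≤
        ; toℚᵘ-injective; toℚᵘ-homo-+; toℚᵘ-homo-*; module ≤-Reasoning)
  renaming (_<?_ to _<ℚ?_)
import Data.Rational.Unnormalised as ℚᵘ
import Data.Rational.Unnormalised.Properties as ℚᵘₚ
open import Data.Rational.Solver using (module +-*-Solver)
open import Data.Fin as Fin using (Fin)
import Data.Fin.Properties as Finₚ
open import Data.List using (List; []; _∷_; length)
open import Data.List.Relation.Unary.All as All using (All; []; _∷_)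
open import Data.List.Relation.Unary.Linked using (Linked; []; [-]; _∷_)
open import Data.Product using (Σ; _×_; _,_)
open import Data.Sum using (inj₁; inj₂)
open import Data.Empty using (⊥-elim)
open import Function using (_∘_)
open import Relation.Nullary using (yes; no; ¬_)
open import Relation.Unary using (Decidable)
open import Relation.Binary.PropositionalEquality

ExtendsPA : Theory → Set
ExtendsPA T = ∀ {χ} → PA χ → T χ

weaken : ∀ {T T' : Theory} → (∀ {χ} → T χ → T' χ) → ∀ {φ} → T ⊢ φ → T' ⊢ φ
weaken T⊆T' (ax a)   = ax a
weaken T⊆T' (hyp h)  = hyp (T⊆T' h)
weaken T⊆T' (mp d e) = mp (weaken T⊆T' d) (weaken T⊆T' e)

weaken-∪ : ∀ {T ψ φ} → T ⊢ φ → T ∪｛ ψ ｝ ⊢ φ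
weaken-∪ = weaken inj₁

assumption : ∀ {T ψ} → T ∪｛ ψ ｝ ⊢ ψ
assumption = hyp (inj₂ refl)

extendsPA-∪ : ∀ {T ψ} → ExtendsPA T → ExtendsPA (T ∪｛ ψ ｝)
extendsPA-∪ pa = inj₁ ∘ pa

-- ψ ⇒ ψ, as the combinator S K K.
⊢-id : ∀ {T} ψ → T ⊢ ψ `⇒ ψ
⊢-id ψ = mp (ax (axK ψ ψ)) (mp (ax (axK ψ (ψ `⇒ ψ))) (ax (axS ψ (ψ `⇒ ψ) ψ)))

-- The deduction theorem; it holds because every axiom is closed under
-- generalization, so modus ponens is the only rule.
deduction : ∀ {T ψ φ} → T ∪｛ ψ ｝ ⊢ φ → T ⊢ ψ `⇒ φ
deduction {ψ = ψ} (ax a)            = mp (ax a) (ax (axK _ ψ))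
deduction {ψ = ψ} (hyp (inj₁ h))    = mp (hyp h) (ax (axK _ ψ))
deduction {ψ = ψ} (hyp (inj₂ refl)) = ⊢-id ψ
deduction {ψ = ψ} (mp {φ} {χ} d e)  =
  mp (deduction d) (mp (deduction e) (ax (axS ψ φ χ)))

cut : ∀ {T ψ φ} → T ⊢ ψ → T ∪｛ ψ ｝ ⊢ φ → T ⊢ φ
cut d e = mp d (deduction e)

by-contradiction : ∀ {T φ} → T ∪｛ `¬ φ ｝ ⊢ `⊥ → T ⊢ φ
by-contradiction d = mp (deduction d) (ax (axDNE _))

contraposition : ∀ {T ψ φ} → T ∪｛ ψ ｝ ⊢ φ → T ∪｛ `¬ φ ｝ ⊢ `¬ ψ
contraposition d =
  deduction (mp (mp assumption (weaken-∪ (weaken-∪ (deduction d)))) (weaken-∪ assumption))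

∧-intro : ∀ {T φ ψ} → T ⊢ φ → T ⊢ ψ → T ⊢ φ `∧ ψ
∧-intro dφ dψ = deduction (mp (weaken-∪ dψ) (mp (weaken-∪ dφ) assumption))

∃-intro : ∀ {T} ψ t → T ⊢ inst t ψ → T ⊢ `∃ ψ
∃-intro ψ t d = deduction (mp (weaken-∪ d) (mp assumption (ax (axInst (`¬ ψ) t))))

step-sound : ∀ {T ψ} → Step T ψ → T ⊢ ψ
step-sound (inj₁ a)           = ax a
step-sound (inj₂ (_ , h , i)) = mp (hyp h) (hyp i)

subT-renT : ∀ σ (ρ : ℕ → ℕ) σ' → (∀ k → σ (ρ k) ≡ σ' k) →
            ∀ t → subT σ (renT ρ t) ≡ subT σ' t
subT-renT σ ρ σ' h (var k)  = h k
subT-renT σ ρ σ' h `0       = refl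
subT-renT σ ρ σ' h (`S t)   = cong `S (subT-renT σ ρ σ' h t)
subT-renT σ ρ σ' h (t `+ u) = cong₂ _`+_ (subT-renT σ ρ σ' h t) (subT-renT σ ρ σ' h u)
subT-renT σ ρ σ' h (t `* u) = cong₂ _`*_ (subT-renT σ ρ σ' h t) (subT-renT σ ρ σ' h u)

subF-renF : ∀ σ (ρ : ℕ → ℕ) σ' → (∀ k → σ (ρ k) ≡ σ' k) →
            ∀ φ → subF σ (renF ρ φ) ≡ subF σ' φ
subF-renF σ ρ σ' h `⊥       = refl
subF-renF σ ρ σ' h (t `≐ u) = cong₂ _`≐_ (subT-renT σ ρ σ' h t) (subT-renT σ ρ σ' h u)
subF-renF σ ρ σ' h (φ `⇒ ψ) = cong₂ _`⇒_ (subF-renF σ ρ σ' h φ) (subF-renF σ ρ σ' h ψ)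
subF-renF σ ρ σ' h (`∀ φ)   = cong `∀ (subF-renF (exts σ) (ext ρ) (exts σ') h' φ)
  where
  h' : ∀ k → exts σ (ext ρ k) ≡ exts σ' k
  h' zero    = refl
  h' (suc k) = cong shiftT (h k)

renT-subT : ∀ (ρ : ℕ → ℕ) σ t → renT ρ (subT σ t) ≡ subT (renT ρ ∘ σ) t
renT-subT ρ σ (var k)  = refl
renT-subT ρ σ `0       = refl
renT-subT ρ σ (`S t)   = cong `S (renT-subT ρ σ t)
renT-subT ρ σ (t `+ u) = cong₂ _`+_ (renT-subT ρ σ t) (renT-subT ρ σ u)
renT-subT ρ σ (t `* u) = cong₂ _`*_ (renT-subT ρ σ t) (renT-subT ρ σ u)

subT-subT : ∀ σ₂ σ₁ σ₃ → (∀ k → subT σ₂ (σ₁ k) ≡ σ₃ k) →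
            ∀ t → subT σ₂ (subT σ₁ t) ≡ subT σ₃ t
subT-subT σ₂ σ₁ σ₃ h (var k)  = h k
subT-subT σ₂ σ₁ σ₃ h `0       = refl
subT-subT σ₂ σ₁ σ₃ h (`S t)   = cong `S (subT-subT σ₂ σ₁ σ₃ h t)
subT-subT σ₂ σ₁ σ₃ h (t `+ u) = cong₂ _`+_ (subT-subT σ₂ σ₁ σ₃ h t) (subT-subT σ₂ σ₁ σ₃ h u)
subT-subT σ₂ σ₁ σ₃ h (t `* u) = cong₂ _`*_ (subT-subT σ₂ σ₁ σ₃ h t) (subT-subT σ₂ σ₁ σ₃ h u)

subF-subF : ∀ σ₂ σ₁ σ₃ → (∀ k → subT σ₂ (σ₁ k) ≡ σ₃ k) →
            ∀ φ → subF σ₂ (subF σ₁ φ) ≡ subF σ₃ φ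
subF-subF σ₂ σ₁ σ₃ h `⊥       = refl
subF-subF σ₂ σ₁ σ₃ h (t `≐ u) = cong₂ _`≐_ (subT-subT σ₂ σ₁ σ₃ h t) (subT-subT σ₂ σ₁ σ₃ h u)
subF-subF σ₂ σ₁ σ₃ h (φ `⇒ ψ) = cong₂ _`⇒_ (subF-subF σ₂ σ₁ σ₃ h φ) (subF-subF σ₂ σ₁ σ₃ h ψ)
subF-subF σ₂ σ₁ σ₃ h (`∀ φ)   = cong `∀ (subF-subF (exts σ₂) (exts σ₁) (exts σ₃) h' φ)
  where
  h' : ∀ k → subT (exts σ₂) (exts σ₁ k) ≡ exts σ₃ k
  h' zero    = refl
  h' (suc k) = begin
    subT (exts σ₂) (shiftT (σ₁ k))  ≡⟨ subT-renT (exts σ₂) suc (shiftT ∘ σ₂) (λ _ → refl) (σ₁ k) ⟩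
    subT (shiftT ∘ σ₂) (σ₁ k)       ≡⟨ renT-subT suc σ₂ (σ₁ k) ⟨
    shiftT (subT σ₂ (σ₁ k))         ≡⟨ cong shiftT (h k) ⟩
    shiftT (σ₃ k)                   ∎
    where open ≡-Reasoning

subT-var : ∀ t → subT var t ≡ t
subT-var (var k)  = refl
subT-var `0       = refl
subT-var (`S t)   = cong `S (subT-var t)
subT-var (t `+ u) = cong₂ _`+_ (subT-var t) (subT-var u)
subT-var (t `* u) = cong₂ _`*_ (subT-var t) (subT-var u)

inst-shiftT : ∀ u t → subT (single u) (shiftT t) ≡ t
inst-shiftT u t = trans (subT-renT (single u) suc var (λ _ → refl) t) (subT-var t)

subT-below : ∀ {n} σ σ' → (∀ k → k <ℕ n → σ k ≡ σ' k) →
             ∀ {t} → TmBelow n t → subT σ t ≡ subT σ' t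
subT-below σ σ' h (var k<n) = h _ k<n
subT-below σ σ' h z         = refl
subT-below σ σ' h (s b)     = cong `S (subT-below σ σ' h b)
subT-below σ σ' h (pl b c)  = cong₂ _`+_ (subT-below σ σ' h b) (subT-below σ σ' h c)
subT-below σ σ' h (ti b c)  = cong₂ _`*_ (subT-below σ σ' h b) (subT-below σ σ' h c)

subF-below : ∀ {n} σ σ' → (∀ k → k <ℕ n → σ k ≡ σ' k) →
             ∀ {φ} → FmBelow n φ → subF σ φ ≡ subF σ' φ
subF-below σ σ' h bot       = refl
subF-below σ σ' h (eq b c)  = cong₂ _`≐_ (subT-below σ σ' h b) (subT-below σ σ' h c)
subF-below σ σ' h (imp b c) = cong₂ _`⇒_ (subF-below σ σ' h b) (subF-below σ σ' h c)
subF-below σ σ' h (all b)   = cong `∀ (subF-below (exts σ) (exts σ') h' b)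
  where
  h' : ∀ k → k <ℕ suc _ → exts σ k ≡ exts σ' k
  h' zero    _         = refl
  h' (suc k) (s≤s k<n) = cong shiftT (h k k<n)

renT-below : ∀ {n n'} (ρ : ℕ → ℕ) → (∀ k → k <ℕ n → ρ k <ℕ n') →
             ∀ {t} → TmBelow n t → TmBelow n' (renT ρ t)
renT-below ρ h (var k<n) = var (h _ k<n)
renT-below ρ h z         = z
renT-below ρ h (s b)     = s (renT-below ρ h b)
renT-below ρ h (pl b c)  = pl (renT-below ρ h b) (renT-below ρ h c)
renT-below ρ h (ti b c)  = ti (renT-below ρ h b) (renT-below ρ h c)

renF-below : ∀ {n n'} (ρ : ℕ → ℕ) → (∀ k → k <ℕ n → ρ k <ℕ n') →
             ∀ {φ} → FmBelow n φ → FmBelow n' (renF ρ φ)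
renF-below ρ h bot       = bot
renF-below ρ h (eq b c)  = eq (renT-below ρ h b) (renT-below ρ h c)
renF-below ρ h (imp b c) = imp (renF-below ρ h b) (renF-below ρ h c)
renF-below ρ h (all b)   = all (renF-below (ext ρ) h' b)
  where
  h' : ∀ k → k <ℕ suc _ → ext ρ k <ℕ suc _
  h' zero    _         = s≤s z≤n
  h' (suc k) (s≤s k<n) = s≤s (h k k<n)

monoT : ∀ {n n'} → n ≤ℕ n' → ∀ {t} → TmBelow n t → TmBelow n' t
monoT n≤n' (var k<n) = var (ℕₚ.≤-trans k<n n≤n')
monoT n≤n' z         = z
monoT n≤n' (s b)     = s (monoT n≤n' b)
monoT n≤n' (pl b c)  = pl (monoT n≤n' b) (monoT n≤n' c)
monoT n≤n' (ti b c)  = ti (monoT n≤n' b) (monoT n≤n' c)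

monoF : ∀ {n n'} → n ≤ℕ n' → ∀ {φ} → FmBelow n φ → FmBelow n' φ
monoF n≤n' bot       = bot
monoF n≤n' (eq b c)  = eq (monoT n≤n' b) (monoT n≤n' c)
monoF n≤n' (imp b c) = imp (monoF n≤n' b) (monoF n≤n' c)
monoF n≤n' (all b)   = all (monoF (s≤s n≤n') b)

module Numerals {T : Theory} (pa : ExtendsPA T) where

  ≐-trans : ∀ {t u w} → T ⊢ t `≐ u → T ⊢ u `≐ w → T ⊢ t `≐ w
  ≐-trans {t} {u} {w} t≐u u≐w =
    subst (_⊢_ T) (cong (_`≐ w) (inst-shiftT w t))
      (mp (subst (_⊢_ T) (cong (_`≐ u) (sym (inst-shiftT u t))) t≐u)
          (mp u≐w (ax (axLeib u w (shiftT t `≐ var 0)))))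

  S-cong : ∀ {t u} → T ⊢ t `≐ u → T ⊢ `S t `≐ `S u
  S-cong {t} {u} t≐u =
    subst (_⊢_ T) (cong (λ x → `S x `≐ `S u) (inst-shiftT u t))
      (mp (subst (_⊢_ T) (cong (λ x → `S x `≐ `S t) (sym (inst-shiftT t t))) (ax (axRefl (`S t))))
          (mp t≐u (ax (axLeib t u (`S (shiftT t) `≐ `S (var 0))))))

  +-zero : ∀ t → T ⊢ t `+ `0 `≐ t
  +-zero t = mp (hyp (pa pa3)) (ax (axInst (var 0 `+ `0 `≐ var 0) t))

  +-suc : ∀ t w → T ⊢ t `+ `S w `≐ `S (t `+ w)
  +-suc t w = subst (_⊢_ T) (cong (λ x → x `+ `S w `≐ `S (x `+ w)) (inst-shiftT w t))
    (mp (mp (hyp (pa pa4)) (ax (axInst (`∀ (var 1 `+ `S (var 0) `≐ `S (var 1 `+ var 0))) t)))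
        (ax (axInst (shiftT t `+ `S (var 0) `≐ `S (shiftT t `+ var 0)) w)))

  num-+ : ∀ a c → T ⊢ num a `+ num c `≐ num (a ℕ.+ c)
  num-+ a zero    = subst (_⊢_ T) (cong (λ x → num a `+ `0 `≐ num x) (sym (ℕₚ.+-identityʳ a)))
                      (+-zero (num a))
  num-+ a (suc c) = subst (_⊢_ T) (cong (λ x → num a `+ `S (num c) `≐ num x) (sym (ℕₚ.+-suc a c)))
                      (≐-trans (+-suc (num a) (num c)) (S-cong (num-+ a c)))

  -- A true strict inequality between numerals is provable: b < x is
  -- witnessed by x ∸ (b + 1).
  num-< : ∀ {b x} → b <ℕ x → T ⊢ num b `< num x
  num-< {b} {x} b<x = ∃-intro (shiftT (num b) `+ `S (var 0) `≐ shiftT (num x)) (num d)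
    (subst (_⊢_ T) (sym (cong₂ (λ u w → u `+ `S (num d) `≐ w) (inst-shiftT _ (num b)) (inst-shiftT _ (num x))))
      (subst (_⊢_ T) (cong (λ y → num b `+ num (suc d) `≐ num y) b+[1+d]≡x) (num-+ b (suc d))))
    where
    d = x ℕ.∸ suc b
    b+[1+d]≡x : b ℕ.+ suc d ≡ x
    b+[1+d]≡x = trans (ℕₚ.+-suc b d) (ℕₚ.m+[n∸m]≡n b<x)

¬-below : ∀ {n φ} → FmBelow n φ → FmBelow n (`¬ φ)
¬-below b = imp b bot

∧-below : ∀ {n φ ψ} → FmBelow n φ → FmBelow n ψ → FmBelow n (φ `∧ ψ)
∧-below b c = ¬-below (imp b (¬-below c))

∃-below : ∀ {n φ} → FmBelow (suc n) φ → FmBelow n (`∃ φ)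
∃-below b = ¬-below (all (¬-below b))

-- Inside Above, the counted formula is lifted over the lower-bound variable.
lift : Formula → Formula
lift = renF (ext suc)

lift-below : ∀ {Q} → FmBelow 1 Q → FmBelow 1 (lift Q)
lift-below = renF-below (ext suc) λ { zero _ → s≤s z≤n ; (suc k) (s≤s ()) }

Above-below : ∀ m {Q} → FmBelow 1 Q → FmBelow 1 (Above m Q)
Above-below zero    bQ = ¬-below bot
Above-below (suc m) bQ = ∃-below (∧-below var1<var0
  (∧-below (monoF (s≤s z≤n) (lift-below bQ)) (monoF (s≤s z≤n) (Above-below m (lift-below bQ)))))
  where
  var1<var0 : FmBelow 2 (var 1 `< var 0)
  var1<var0 = ∃-below (eq (pl (var (s≤s (s≤s (s≤s z≤n)))) (s (var (s≤s z≤n)))) (var (s≤s (s≤s z≤n))))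

subF-unary : ∀ σ t {Q} → FmBelow 1 Q → σ 0 ≡ t → subF σ Q ≡ inst t Q
subF-unary σ t bQ σ0≡t = subF-below σ (single t) (λ { zero _ → σ0≡t ; (suc k) (s≤s ()) }) bQ

subF-lift : ∀ σ {Q} → FmBelow 1 Q → subF σ (lift Q) ≡ inst (σ 0) Q
subF-lift σ {Q} bQ =
  trans (subF-renF σ (ext suc) (σ ∘ ext suc) (λ _ → refl) Q) (subF-unary (σ ∘ ext suc) (σ 0) bQ refl)

Increasing : List ℕ → Set
Increasing = Linked _<ℕ_

module Counting {T : Theory} (pa : ExtendsPA T) where
  open Numerals pa

  above-intro : ∀ m Q b xs → FmBelow 1 Q → Increasing (b ∷ xs) → m ≤ℕ length xs →
                All (λ y → T ⊢ inst (num y) Q) xs → T ⊢ inst (num b) (Above m Q)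
  above-intro zero    _ _ _        _  _             _        _             = ⊢-id `⊥
  above-intro (suc m) Q b (y ∷ ys) bQ (b<y ∷ inc) (s≤s m≤) (⊢Qy ∷ ⊢Qys) =
    ∃-intro (subF (exts (single (num b))) body) (num y)
      (subst (_⊢_ T) (sym (subF-subF (single (num y)) (exts (single (num b))) σ (λ _ → refl) body))
        (∧-intro ⊢b<y (∧-intro ⊢Q[y] ⊢Above[y])))
    where
    body = (var 1 `< var 0) `∧ lift Q `∧ Above m (lift Q)
    -- the substitution b, y for variables 1, 0 of the body
    σ : ℕ → Term
    σ k = subT (single (num y)) (exts (single (num b)) k)
    ⊢b<y : T ⊢ subF σ (var 1 `< var 0)
    ⊢b<y = subst (_⊢_ T) (cong (_`< num y) (sym (inst-shiftT (num y) (num b)))) (num-< b<y)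
    ⊢Q[y] : T ⊢ subF σ (lift Q)
    ⊢Q[y] = subst (_⊢_ T) (sym (subF-lift σ bQ)) ⊢Qy
    ⊢Above[y] : T ⊢ subF σ (Above m (lift Q))
    ⊢Above[y] = subst (_⊢_ T) (sym (subF-unary σ (num y) (Above-below m (lift-below bQ)) refl))
      (above-intro m (lift Q) y ys (lift-below bQ) inc m≤ (All.map (subst (_⊢_ T) (sym (subF-lift _ bQ))) ⊢Qys))

  atLeast-intro : ∀ m Q xs → FmBelow 1 Q → Increasing xs → m ≤ℕ length xs →
                  All (λ y → T ⊢ inst (num y) Q) xs → T ⊢ AtLeast m Q
  atLeast-intro zero    _ _        _  _   _        _            = ⊢-id `⊥
  atLeast-intro (suc m) Q (x ∷ xs) bQ inc (s≤s m≤) (⊢Qx ∷ ⊢Qxs) =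
    ∃-intro (Q `∧ Above m Q) (num x) (∧-intro ⊢Qx (above-intro m Q x xs bQ inc m≤ ⊢Qxs))

insert : ℕ → List ℕ → List ℕ
insert v []       = v ∷ []
insert v (y ∷ ys) with v ℕ.<? y
... | yes _ = v ∷ y ∷ ys
... | no  _ = y ∷ insert v ys

insert-length : ∀ v xs → length (insert v xs) ≡ suc (length xs)
insert-length v []       = refl
insert-length v (y ∷ ys) with v ℕ.<? y
... | yes _ = refl
... | no  _ = cong suc (insert-length v ys)

insert-all : ∀ {P : ℕ → Set} v xs → P v → All P xs → All P (insert v xs)
insert-all v []       Pv []          = Pv ∷ []
insert-all v (y ∷ ys) Pv (Py ∷ Pys) with v ℕ.<? y
... | yes _ = Pv ∷ Py ∷ Pys
... | no  _ = Py ∷ insert-all v ys Pv Pys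

>-of-≮-≢ : ∀ {v y} → ¬ (v <ℕ y) → v ≢ y → y <ℕ v
>-of-≮-≢ v≮y v≢y = ℕₚ.≤∧≢⇒< (ℕₚ.≮⇒≥ v≮y) (v≢y ∘ sym)

insert-above : ∀ {b} v xs → b <ℕ v → All (v ≢_) xs →
               Increasing (b ∷ xs) → Increasing (b ∷ insert v xs)
insert-above v []       b<v _              _           = b<v ∷ [-]
insert-above v (y ∷ ys) b<v (v≢y ∷ v∉ys) (b<y ∷ inc) with v ℕ.<? y
... | yes v<y = b<v ∷ v<y ∷ inc
... | no  v≮y = b<y ∷ insert-above v ys (>-of-≮-≢ v≮y v≢y) v∉ys inc

insert-increasing : ∀ v xs → All (v ≢_) xs → Increasing xs → Increasing (insert v xs)
insert-increasing v []       _              _   = [-]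
insert-increasing v (y ∷ ys) (v≢y ∷ v∉ys) inc with v ℕ.<? y
... | yes v<y = v<y ∷ inc
... | no  v≮y = insert-above v ys (>-of-≮-≢ v≮y v≢y) v∉ys inc

count : ∀ {n} {G : Fin n → Set} → Decidable G → ℕ
count {zero}  G? = 0
count {suc n} G? with G? Fin.zero
... | yes _ = suc (count (G? ∘ Fin.suc))
... | no  _ = count (G? ∘ Fin.suc)

ValueOn : ∀ {n} → (Fin n → ℕ) → (Fin n → Set) → ℕ → Set
ValueOn {n} v G y = Σ (Fin n) λ i → G i × v i ≡ y

ValueOn-suc : ∀ {n} {v : Fin (suc n) → ℕ} {G y} → ValueOn (v ∘ Fin.suc) (G ∘ Fin.suc) y → ValueOn v G y
ValueOn-suc (i , g , e) = Fin.suc i , g , e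

enumerate : ∀ {n} (v : Fin n → ℕ) → (∀ i j → v i ≡ v j → i ≡ j) →
            {G : Fin n → Set} (G? : Decidable G) →
            Σ (List ℕ) λ L → Increasing L × All (ValueOn v G) L × length L ≡ count G?
enumerate {zero}  v inj G? = [] , [] , [] , refl
enumerate {suc n} v inj {G} G? with G? Fin.zero
    | enumerate (v ∘ Fin.suc) (λ i j e → Finₚ.suc-injective (inj (Fin.suc i) (Fin.suc j) e)) (G? ∘ Fin.suc)
... | no  _  | L , inc , values , len = L , inc , All.map ValueOn-suc values , len
... | yes g₀ | L , inc , values , len =
  insert (v Fin.zero) L ,
  insert-increasing (v Fin.zero) L (All.map new values) inc ,
  insert-all (v Fin.zero) L (Fin.zero , g₀ , refl) (All.map ValueOn-suc values) ,
  trans (insert-length (v Fin.zero) L) (cong suc len)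
  where
  new : ∀ {y} → ValueOn (v ∘ Fin.suc) (G ∘ Fin.suc) y → v Fin.zero ≢ y
  new (i , _ , e) e₀ = Finₚ.0≢1+n (inj Fin.zero (Fin.suc i) (trans e₀ (sym e)))

open +-*-Solver

fromℕ : ℕ → ℚ
fromℕ n = + n / 1

toℚᵘ-fromℕ : ∀ n → toℚᵘ (fromℕ n) ℚᵘ.≃ ℚᵘ.mkℚᵘ (+ n) 0
toℚᵘ-fromℕ n = toℚᵘ-fromℚᵘ (ℚᵘ.mkℚᵘ (+ n) 0)

fromℕ-suc : ∀ n → fromℕ (suc n) ≡ 1ℚ + fromℕ n
fromℕ-suc n = toℚᵘ-injective (begin-equality
  toℚᵘ (fromℕ (suc n))                   ≃⟨ toℚᵘ-fromℕ (suc n) ⟩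
  ℚᵘ.mkℚᵘ (+ suc n) 0                     ≃⟨ ℚᵘ.*≡* cross ⟩
  toℚᵘ 1ℚ ℚᵘ.+ ℚᵘ.mkℚᵘ (+ n) 0           ≃⟨ ℚᵘₚ.+-congʳ (toℚᵘ 1ℚ) (toℚᵘ-fromℕ n) ⟨
  toℚᵘ 1ℚ ℚᵘ.+ toℚᵘ (fromℕ n)            ≃⟨ toℚᵘ-homo-+ 1ℚ (fromℕ n) ⟨
  toℚᵘ (1ℚ + fromℕ n)                    ∎)
  where
  open ℚᵘₚ.≤-Reasoning
  cross : + suc n ℤ.* + 1 ≡ (+ 1 ℤ.* + 1 ℤ.+ + n ℤ.* + 1) ℤ.* + 1
  cross = trans (ℤₚ.*-identityʳ (+ suc n))
            (sym (trans (ℤₚ.*-identityʳ _) (cong (ℤ._+_ (+ 1)) (ℤₚ.*-identityʳ (+ n)))))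

fromℕ-*-recip : ∀ k → fromℕ (suc k) * (+ 1 / suc k) ≡ 1ℚ
fromℕ-*-recip k = toℚᵘ-injective (begin-equality
  toℚᵘ (fromℕ (suc k) * (+ 1 / suc k))                ≃⟨ toℚᵘ-homo-* (fromℕ (suc k)) (+ 1 / suc k) ⟩
  toℚᵘ (fromℕ (suc k)) ℚᵘ.* toℚᵘ (+ 1 / suc k)       ≃⟨ ℚᵘₚ.*-cong (toℚᵘ-fromℕ (suc k)) (toℚᵘ-fromℚᵘ (ℚᵘ.mkℚᵘ (+ 1) k)) ⟩
  ℚᵘ.mkℚᵘ (+ suc k) 0 ℚᵘ.* ℚᵘ.mkℚᵘ (+ 1) k           ≃⟨ ℚᵘ.*≡* cross ⟩
  toℚᵘ 1ℚ                                             ∎)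
  where
  open ℚᵘₚ.≤-Reasoning
  cross : (+ suc k ℤ.* + 1) ℤ.* + 1 ≡ + 1 ℤ.* + (suc 0 ℕ.* suc k)
  cross = cong +_ (trans (ℕₚ.*-identityʳ _) (trans (ℕₚ.*-identityʳ _)
                    (sym (trans (ℕₚ.*-identityˡ _) (ℕₚ.*-identityˡ _)))))

-- ⌊τ·N⌋ ≤ τ·N: if g ≤ ⌊a·N/d⌋ then g·d ≤ a·N, i.e. g ≤ (a/d)·N.
floor-≤ : ∀ g τ N → 0ℚ < τ → g ≤ℕ ⌊ τ · N ⌋ → fromℕ g ≤ τ * fromℕ N
floor-≤ g (mkℚ (+ zero)    d-1 _) N (*<* (ℤ.+<+ ()))
floor-≤ g (mkℚ -[1+ _ ]    d-1 _) N (*<* ())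
floor-≤ g τ@(mkℚ (+ suc a) d-1 _) N _ g≤⌊τN⌋ = toℚᵘ-cancel-≤ (begin
  toℚᵘ (fromℕ g)                  ≃⟨ toℚᵘ-fromℕ g ⟩
  ℚᵘ.mkℚᵘ (+ g) 0                 ≤⟨ ℚᵘ.*≤* cross ⟩
  toℚᵘ τ ℚᵘ.* ℚᵘ.mkℚᵘ (+ N) 0     ≃⟨ ℚᵘₚ.*-congˡ {toℚᵘ τ} (toℚᵘ-fromℕ N) ⟨
  toℚᵘ τ ℚᵘ.* toℚᵘ (fromℕ N)      ≃⟨ toℚᵘ-homo-* τ (fromℕ N) ⟨
  toℚᵘ (τ * fromℕ N)              ∎)
  where
  open ℚᵘₚ.≤-Reasoning
  g*d≤a*N : g ℕ.* suc d-1 ≤ℕ suc a ℕ.* N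
  g*d≤a*N = ℕₚ.≤-trans (ℕₚ.*-monoˡ-≤ (suc d-1) g≤⌊τN⌋) (m/n*n≤m (suc a ℕ.* N) (suc d-1))
  cross : + g ℤ.* + (suc d-1 ℕ.* 1) ℤ.≤ (+ suc a ℤ.* + N) ℤ.* + 1
  cross = subst₂ ℤ._≤_ (ℤₚ.pos-* g (suc d-1 ℕ.* 1))
            (trans (ℤₚ.pos-* (suc a ℕ.* N) 1) (cong (λ z → z ℤ.* + 1) (ℤₚ.pos-* (suc a) N)))
            (ℤ.+≤+ (subst₂ _≤ℕ_ (cong (g ℕ.*_) (sym (ℕₚ.*-identityʳ (suc d-1))))
                                 (sym (ℕₚ.*-identityʳ (suc a ℕ.* N))) g*d≤a*N))

average-≤ : ∀ k x y → x ≤ fromℕ (suc k) * y → x * (+ 1 / suc k) ≤ y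
average-≤ k x y x≤Ny = begin
  x * r                  ≤⟨ *-monoʳ-≤-nonNeg r {{normalize-nonNeg 1 (suc k)}} x≤Ny ⟩
  fromℕ (suc k) * y * r  ≡⟨ solve 3 (λ n y r → n :* y :* r := y :* (n :* r)) refl (fromℕ (suc k)) y r ⟩
  y * (fromℕ (suc k) * r) ≡⟨ cong (y *_) (fromℕ-*-recip k) ⟩
  y * 1ℚ                 ≡⟨ *-identityʳ y ⟩
  y                      ∎
  where
  open ≤-Reasoning
  r = + 1 / suc k

sumFin-≤ : ∀ {n} (f : Fin n → ℚ) c → (∀ i → f i ≤ c) → sumFin f ≤ fromℕ n * c
sumFin-≤ {zero}  f c f≤c = ≤-reflexive (sym (solve 1 (λ c → con 0ℚ :* c := con 0ℚ) refl c))
sumFin-≤ {suc n} f c f≤c = begin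
  f Fin.zero + sumFin (f ∘ Fin.suc)  ≤⟨ +-mono-≤ (f≤c Fin.zero) (sumFin-≤ (f ∘ Fin.suc) c (f≤c ∘ Fin.suc)) ⟩
  c + fromℕ n * c                   ≡⟨ solve 2 (λ c n → c :+ n :* c := (con 1ℚ :+ n) :* c) refl c (fromℕ n) ⟩
  (1ℚ + fromℕ n) * c                ≡⟨ cong (_* c) (fromℕ-suc n) ⟨
  fromℕ (suc n) * c                 ∎
  where open ≤-Reasoning

sumFin-≤-count : ∀ {n} (f : Fin n → ℚ) {G : Fin n → Set} (G? : Decidable G) c → 0ℚ ≤ c →
                 (∀ i → G i → f i ≤ 1ℚ) → (∀ i → ¬ G i → f i ≤ c) →
                 sumFin f ≤ fromℕ n * c + fromℕ (count G?)
sumFin-≤-count {zero} f G? c _ _ _ = ≤-reflexive (sym (solve 1 (λ c → con 0ℚ :* c :+ con 0ℚ := con 0ℚ) refl c))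
sumFin-≤-count {suc n} f G? c 0≤c on-G off-G with G? Fin.zero
    | sumFin-≤-count (f ∘ Fin.suc) (G? ∘ Fin.suc) c 0≤c (on-G ∘ Fin.suc) (off-G ∘ Fin.suc)
... | yes g | IH = begin
  f Fin.zero + sumFin (f ∘ Fin.suc)     ≤⟨ +-mono-≤ (≤-trans (on-G Fin.zero g) 1≤1+c) IH ⟩
  (1ℚ + c) + (fromℕ n * c + fromℕ k)   ≡⟨ solve 3 (λ c n k → (con 1ℚ :+ c) :+ (n :* c :+ k)
                                                        := (con 1ℚ :+ n) :* c :+ (con 1ℚ :+ k)) refl c (fromℕ n) (fromℕ k) ⟩
  (1ℚ + fromℕ n) * c + (1ℚ + fromℕ k)  ≡⟨ cong₂ (λ a b → a * c + b) (fromℕ-suc n) (fromℕ-suc k) ⟨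
  fromℕ (suc n) * c + fromℕ (suc k)    ∎
  where
  open ≤-Reasoning
  k = count (G? ∘ Fin.suc)
  1≤1+c : 1ℚ ≤ 1ℚ + c
  1≤1+c = ≤-trans (≤-reflexive (sym (+-identityʳ 1ℚ))) (+-monoʳ-≤ 1ℚ 0≤c)
... | no ¬g | IH = begin
  f Fin.zero + sumFin (f ∘ Fin.suc)     ≤⟨ +-mono-≤ (off-G Fin.zero ¬g) IH ⟩
  c + (fromℕ n * c + fromℕ k)          ≡⟨ solve 3 (λ c n k → c :+ (n :* c :+ k) := (con 1ℚ :+ n) :* c :+ k)
                                                   refl c (fromℕ n) (fromℕ k) ⟩
  (1ℚ + fromℕ n) * c + fromℕ k         ≡⟨ cong (λ a → a * c + fromℕ k) (fromℕ-suc n) ⟨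
  fromℕ (suc n) * c + fromℕ k          ∎
  where
  open ≤-Reasoning
  k = count (G? ∘ Fin.suc)

0≤-of-≤ : ∀ {p q} → p ≤ q → 0ℚ ≤ q - p
0≤-of-≤ {p} p≤q = ≤-trans (≤-reflexive (sym (+-inverseʳ p))) (+-monoˡ-≤ (- p) p≤q)

-- Otherwise the sum would be at most N·(δ − τ) + τ·N = N·δ.
many-exceed : ∀ {k} (ps : Fin (suc k) → ℚ) τ δ → 0ℚ < τ → τ ≤ δ → (∀ i → ps i ≤ 1ℚ) →
              δ < sumFin ps * (+ 1 / suc k) → ⌊ τ · suc k ⌋ <ℕ count (λ i → (δ - τ) <ℚ? ps i)
many-exceed {k} ps τ δ 0<τ τ≤δ ps≤1 δ<average =
  ℕₚ.≰⇒> λ few → <-irrefl refl (<-≤-trans δ<average (average-≤ k (sumFin ps) δ (sum≤Nδ few)))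
  where
  open ≤-Reasoning
  N = fromℕ (suc k)
  c = δ - τ
  G? = λ i → c <ℚ? ps i
  sum≤Nδ : count G? ≤ℕ ⌊ τ · suc k ⌋ → sumFin ps ≤ N * δ
  sum≤Nδ few = begin
    sumFin ps              ≤⟨ sumFin-≤-count ps G? c (0≤-of-≤ τ≤δ) (λ i _ → ps≤1 i) (λ i → ≮⇒≥) ⟩
    N * c + fromℕ (count G?) ≤⟨ +-monoʳ-≤ (N * c) (floor-≤ (count G?) τ (suc k) 0<τ few) ⟩
    N * c + τ * N          ≡⟨ solve 3 (λ N δ τ → N :* (δ :- τ) :+ τ :* N := N :* δ) refl N δ τ ⟩
    N * δ                  ∎

probability-≤-1 : ∀ {φ T δ} {π : Strategy T δ} {p} → ProbProved φ π p → p ≤ 1ℚ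
probability-≤-1 (leaf-in _)  = ≤-refl
probability-≤-1 (leaf-out _) = *≤* (ℤ.+≤+ z≤n)
probability-≤-1 (det pp)     = probability-≤-1 pp
probability-≤-1 (prob {A = A} ps pps) =
  average-≤ (size-1 A) (sumFin ps) 1ℚ (sumFin-≤ ps 1ℚ (λ i → probability-≤-1 (pps i)))

-- The logic of a probabilistic node: if more than ⌊τ·|A|⌋ elements a of A
-- satisfy T ∪ {R(a)} ⊢ φ, then they witness in T ∪ {¬φ} that too many
-- elements of A violate R, contradicting the axiom (∀_τ x ∈ A) R(x) of T.
refute-by-counting : ∀ {T φ τ A Aφ R} → ExtendsPA T → Represents A Aφ → FmBelow 1 R →
                     T (ForallTau τ A Aφ R) →
                     {G : Fin (size A) → Set} (G? : Decidable G) → ⌊ τ · size A ⌋ <ℕ count G? →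
                     (∀ i → G i → T ∪｛ inst (num (elem A i)) R ｝ ⊢ φ) → T ⊢ φ
refute-by-counting {T} {φ} {τ} {A} {Aφ} {R} pa (bA , A-true , _ , _) bR axiom {G} G? many R⇒φ
  with enumerate (elem A) (distinct A) G?
... | L , increasing , values , len =
  by-contradiction (mp (atLeast-intro (suc ⌊ τ · size A ⌋) (Aφ `∧ `¬ R) L (∧-below bA (¬-below bR))
                                      increasing (subst (_ ≤ℕ_) (sym len) many) (All.map violates values))
                       (weaken-∪ (hyp axiom)))
  where
  open Counting (extendsPA-∪ {ψ = `¬ φ} pa)
  violates : ∀ {y} → ValueOn (elem A) G y → T ∪｛ `¬ φ ｝ ⊢ inst (num y) (Aφ `∧ `¬ R)
  violates (i , g , refl) = ∧-intro (weaken (extendsPA-∪ pa) (A-true i)) (contraposition (R⇒φ i g))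

-- Soundness, strengthened for the induction: in any theory extending PA, a
-- node with capital δ ≥ 0 proving φ with probability above δ yields a proof.
soundness : ∀ {φ T δ} {π : Strategy T δ} {p} → ExtendsPA T →
            ProbProved φ π p → 0ℚ ≤ δ → δ < p → T ⊢ φ
soundness pa (leaf-in φ∈T) _   _   = hyp φ∈T
soundness pa (leaf-out _)  0≤δ δ<0 = ⊥-elim (<-irrefl refl (≤-<-trans 0≤δ δ<0))
soundness pa (det {st = step} pp) 0≤δ δ<p =
  cut (step-sound step) (soundness (extendsPA-∪ pa) pp 0≤δ δ<p)
soundness {δ = δ} pa (prob {A = A} {Aφ} {R} {τ} {rep} {bR} {0<τ} {τ≤δ} {axiom} ps pps) 0≤δ δ<p =
  refute-by-counting {τ = τ} {A} {Aφ} {R} pa rep bR axiom (λ i → (δ - τ) <ℚ? ps i)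
    (many-exceed ps τ δ 0<τ τ≤δ (λ i → probability-≤-1 (pps i)) δ<p)
    (λ i → soundness (extendsPA-∪ pa) (pps i) (0≤-of-≤ τ≤δ))

-- The theorem is the case T = PA.
theorem2 : (φ : Formula) → Sentence φ →
    (ε : ℚ) → 0ℚ ≤ ε → ε ≤ 1ℚ →
    (π : Strategy PA ε) → (p : ℚ) → ProbProved φ π p → ε < p →
    PA ⊢ φ
theorem2 _ _ _ 0≤ε _ _ _ proved ε<p = soundness (λ axiom → axiom) proved 0≤ε ε<p
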